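{- Let $k\ge 2$ and let $G$ be a $P_k$-homomorphism-saturated digraph on a vertex set $V$ with $|V|\ge k-1$. Then there is a partition $V=G_1\sqcup G_2\sqcup\cdots\sqcup G_{k-1}$ into vertex classes such that the arcs of $G$ are exactly the ordered pairs $(u,v)$ with $u\in G_i$, $v\in G_j$ and $i<j$. Moreover, if $|V|\ge k$ then $|G_i|>0$ for all $i$; otherwise $|G_i|\le 1$ for all $i$.
   Context: Digraphs have no loops. $P_k$ is the directed path on $k$ vertices. A digraph homomorphism $F\to G$ is a vertex map sending arcs to arcs; $G$ is $P_k$-homomorphism-free if there is no homomorphism $P_k\to G$ (equivalently, $G$ has no directed walk on $k$ vertices). $G$ on vertex set $V$ is $P_k$-homomorphism-saturated if it is $P_k$-homomorphism-free and adding any ordered pair $(u,v)$ of distinct vertices of $V$ that is not already an arc of $G$ creates a homomorphism from $P_k$. -}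

module Defs where

open import Data.Nat using (ℕ)
import Data.Nat as ℕ
open import Data.Fin using (Fin; toℕ)
open import Data.Bool using (Bool; true; false)
open import Data.Product using (Σ; _×_)
open import Data.Sum using (_⊎_)
open import Relation.Binary.PropositionalEquality using (_≡_; _≢_)
open import Relation.Nullary using (¬_)

Digraph : ℕ → Set
Digraph n = Fin n → Fin n → Bool

Arc : ∀ {n} → Digraph n → Fin n → Fin n → Set
Arc G u v = G u v ≡ true

Loopless : ∀ {n} → Digraph n → Set
Loopless G = ∀ u → ¬ Arc G u u

AddArc : ∀ {n} → Digraph n → Fin n → Fin n → Fin n → Fin n → Set
AddArc G u v x y = Arc G x y ⊎ (x ≡ u × y ≡ v)

-- Homomorphism from the directed path P_k (vertices 0,…,k-1, arcs i → i+1)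
-- into the arc relation R on V.
PathHom : (k : ℕ) {V : Set} → (V → V → Set) → Set
PathHom k {V} R =
  Σ (Fin k → V) λ f → ∀ (i j : Fin k) → toℕ j ≡ ℕ.suc (toℕ i) → R (f i) (f j)

HomFree : (k : ℕ) → ∀ {n} → Digraph n → Set
HomFree k G = ¬ PathHom k (Arc G)

Saturated : (k : ℕ) → ∀ {n} → Digraph n → Set
Saturated k {n} G =
  HomFree k G ×
  (∀ (u v : Fin n) → u ≢ v → ¬ Arc G u v → PathHom k (AddArc G u v))

-- Colour a vertex by its depth, the number of arcs of a longest walk ending
-- there. P_k-freeness bounds depths by k − 2 and arcs strictly raise depth;
-- conversely no function bounded by k − 2 and raised along every arc admits
-- P_k. Saturation therefore puts in every arc from lower to higher depth. If
-- depth k − 2 were never reached, two vertices u, v would share a depth j, and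
-- raising by one all depths above j and that of v keeps such a function while
-- also raising along u → v, contradicting saturation. Every depth below a
-- reached one is reached along a longest walk, so all colours occur; when
-- there are only k − 1 vertices, a surjection onto k − 1 colours is injective.
module Submission where

open import Defs
open import Data.Nat using (ℕ; _≤_; _<_; _∸_; zero; suc; z≤n; s≤s; _+_)
open import Data.Nat.Properties
open import Data.Fin using (Fin; toℕ; fromℕ; fromℕ<; inject₁; opposite)
import Data.Fin as F
open import Data.Fin.Properties
  using (toℕ-fromℕ; toℕ-fromℕ<; toℕ-inject₁; toℕ<n; toℕ-injective; opposite-prop; any?; <⇒notInjective)
  renaming (_≟_ to _≟ᶠ_)
open import Data.Fin.Induction using (<-weakInduction)
open import Data.Bool using (true) renaming (_≟_ to _≟ᵇ_)
open import Data.Product using (Σ; ∃; _×_; _,_; proj₁; proj₂)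
open import Data.Sum using (_⊎_; inj₁; inj₂)
open import Data.Unit using (⊤; tt)
open import Data.Empty using (⊥; ⊥-elim)
open import Function using (flip; _∘_)
open import Function.Bundles using (_⇔_; mk⇔)
open import Function.Definitions using (Injective)
open import Relation.Nullary using (¬_; Dec; yes; no)
open import Relation.Nullary.Decidable using (decidable-stable; _×-dec_; _⊎-dec_)
open import Relation.Unary using (Decidable)
open import Relation.Binary.PropositionalEquality

potential⇒¬PathHom : {V : Set} {R : V → V → Set} (B : ℕ) (ψ : V → ℕ) →
  (∀ x → ψ x ≤ B) → (∀ {x y} → R x y → ψ x < ψ y) → ¬ PathHom (suc (suc B)) R
potential⇒¬PathHom B ψ bounded increasing (f , hom) =
  1+n≰n (≤-trans top-climbs (bounded (f (fromℕ (suc B)))))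
  where
  climbs : ∀ i → toℕ i ≤ ψ (f i)
  climbs = <-weakInduction (λ i → toℕ i ≤ ψ (f i)) z≤n λ i ih →
    ≤-<-trans (subst (_≤ ψ (f (inject₁ i))) (toℕ-inject₁ i) ih)
              (increasing (hom (inject₁ i) (F.suc i) (cong suc (sym (toℕ-inject₁ i)))))
  top-climbs : suc B ≤ ψ (f (fromℕ (suc B)))
  top-climbs = subst (_≤ ψ (f (fromℕ (suc B)))) (toℕ-fromℕ (suc B)) (climbs (fromℕ (suc B)))

PathHom-flip : ∀ {k} {V : Set} {R : V → V → Set} → PathHom k (flip R) → PathHom k R
PathHom-flip {k} (f , hom) = f ∘ opposite , λ i j j≡1+i → hom (opposite j) (opposite i) (reversed i j j≡1+i)
  where
  open ≡-Reasoning
  reversed : ∀ (i j : Fin k) → toℕ j ≡ suc (toℕ i) → toℕ (opposite i) ≡ suc (toℕ (opposite j))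
  reversed i j j≡1+i = begin
    toℕ (opposite i)         ≡⟨ opposite-prop i ⟩
    k ∸ suc (toℕ i)          ≡⟨ cong (k ∸_) (sym j≡1+i) ⟩
    k ∸ toℕ j                ≡⟨ +-∸-assoc 1 (toℕ<n j) ⟩
    suc (k ∸ suc (toℕ j))    ≡⟨ cong suc (opposite-prop j) ⟨
    suc (toℕ (opposite j))   ∎

module _ {V : Set} (R : V → V → Set) where

  WalkFrom : ℕ → V → Set
  WalkFrom zero    v = ⊤
  WalkFrom (suc m) v = ∃ λ u → R v u × WalkFrom m u

  walk-shorten : ∀ {t m v} → t ≤ m → WalkFrom m v → WalkFrom t v
  walk-shorten z≤n       _             = tt
  walk-shorten (s≤s t≤m) (u , a , w) = u , a , walk-shorten t≤m w

  walk⇒PathHom : ∀ {m v} → WalkFrom m v → PathHom (suc m) R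
  walk⇒PathHom w = vertices w , steps w
    where
    vertices : ∀ {m v} → WalkFrom m v → Fin (suc m) → V
    vertices {v = v} _           F.zero      = v
    vertices {suc _} (_ , _ , w) (F.suc i)   = vertices w i
    vertices {zero}  _           (F.suc ())
    steps : ∀ {m v} (w : WalkFrom m v) (i j : Fin (suc m)) →
            toℕ j ≡ suc (toℕ i) → R (vertices w i) (vertices w j)
    steps {suc _} (_ , a , _) F.zero    (F.suc F.zero)    _  = a
    steps {suc _} (_ , _ , w) (F.suc i) (F.suc j)         eq = steps w i j (suc-injective eq)
    steps {suc _} _           F.zero    (F.suc (F.suc _)) ()
    steps {zero}  _           F.zero    (F.suc ())        _
    steps {zero}  _           (F.suc ()) _                _
    steps         _           _         F.zero            ()

walk? : ∀ {n} {R : Fin n → Fin n → Set} → (∀ u v → Dec (R u v)) → ∀ m → Decidable (WalkFrom R m)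
walk? R? zero    v = yes tt
walk? R? (suc m) v = any? λ u → R? v u ×-dec walk? R? m u

module Greatest {P : ℕ → Set} (P? : Decidable P) (P0 : P 0) where

  greatest : ℕ → ℕ
  greatest zero = zero
  greatest (suc m) with P? (suc m)
  ... | yes _ = suc m
  ... | no  _ = greatest m

  greatest-≤ : ∀ m → greatest m ≤ m
  greatest-≤ zero = z≤n
  greatest-≤ (suc m) with P? (suc m)
  ... | yes _ = ≤-refl
  ... | no  _ = m≤n⇒m≤1+n (greatest-≤ m)

  greatest-holds : ∀ m → P (greatest m)
  greatest-holds zero = P0
  greatest-holds (suc m) with P? (suc m)
  ... | yes p = p
  ... | no  _ = greatest-holds m

  greatest-maximal : ∀ {t} m → t ≤ m → P t → t ≤ greatest m
  greatest-maximal zero    t≤m _ = t≤m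
  greatest-maximal (suc m) t≤m p with P? (suc m) | m≤n⇒m<n∨m≡n t≤m
  ... | yes _ | _        = t≤m
  ... | no  _ | inj₁ t<m = greatest-maximal m (≤-pred t<m) p
  ... | no ¬p | inj₂ refl = ⊥-elim (¬p p)

image-downClosed : {A : Set} (c : A → ℕ) → (∀ v m → c v ≡ suc m → ∃ λ u → c u ≡ m) →
  ∀ v t → t ≤ c v → ∃ λ u → c u ≡ t
image-downClosed c pred v t t≤cv = descend (c v ∸ t) v (sym (m∸n+n≡m t≤cv))
  where
  descend : ∀ d v → c v ≡ d + t → ∃ λ u → c u ≡ t
  descend zero    v cv≡t = v , cv≡t
  descend (suc d) v cv≡1+d+t with u , cu≡d+t ← pred v (d + t) cv≡1+d+t = descend d u cu≡d+t

toFin : {A : Set} (c : A → ℕ) {m : ℕ} → (∀ x → c x < m) → A → Fin m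
toFin c bounded x = fromℕ< (bounded x)

toℕ-toFin : {A : Set} (c : A → ℕ) {m : ℕ} (bounded : ∀ x → c x < m) → ∀ x → toℕ (toFin c bounded x) ≡ c x
toℕ-toFin c bounded x = toℕ-fromℕ< (bounded x)

toFin-injective : {A : Set} (c : A → ℕ) {m : ℕ} (bounded : ∀ x → c x < m) →
  Injective _≡_ _≡_ c → Injective _≡_ _≡_ (toFin c bounded)
toFin-injective c bounded c-injective {x} {y} eq = c-injective (begin
  c x                        ≡⟨ toℕ-toFin c bounded x ⟨
  toℕ (toFin c bounded x)    ≡⟨ cong toℕ eq ⟩
  toℕ (toFin c bounded y)    ≡⟨ toℕ-toFin c bounded y ⟩
  c y                        ∎)
  where open ≡-Reasoning

surjective⇒injective : ∀ {n m} → n ≤ m → (f : Fin n → Fin m) → (∀ i → ∃ λ u → f u ≡ i) → Injective _≡_ _≡_ f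
surjective⇒injective {n} {m} n≤m f surjective {u} {v} fu≡fv = begin
  u              ≡⟨ section-retracts u ⟨
  section (f u)  ≡⟨ cong section fu≡fv ⟩
  section (f v)  ≡⟨ section-retracts v ⟩
  v              ∎
  where
  open ≡-Reasoning
  section : Fin m → Fin n
  section i = proj₁ (surjective i)
  f-section : ∀ i → f (section i) ≡ i
  f-section i = proj₂ (surjective i)
  -- If u were missing from the image of the section, the section extended by u
  -- would inject Fin (suc m) into Fin n.
  section-retracts : ∀ u → section (f u) ≡ u
  section-retracts u = decidable-stable (section (f u) ≟ᶠ u) λ missing →
    <⇒notInjective (s≤s n≤m) (extended-injective missing)
    where
    hit : ∀ {j} → section j ≡ u → section (f u) ≡ u
    hit {j} sj≡u = trans (cong (section ∘ f) (sym sj≡u)) (trans (cong section (f-section j)) sj≡u)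
    extended : Fin (suc m) → Fin n
    extended F.zero    = u
    extended (F.suc i) = section i
    extended-injective : section (f u) ≢ u → Injective _≡_ _≡_ extended
    extended-injective _       {F.zero}  {F.zero}  _     = refl
    extended-injective missing {F.zero}  {F.suc _} u≡sj  = ⊥-elim (missing (hit (sym u≡sj)))
    extended-injective missing {F.suc _} {F.zero}  si≡u  = ⊥-elim (missing (hit si≡u))
    extended-injective _       {F.suc i} {F.suc j} si≡sj =
      cong F.suc (trans (sym (f-section i)) (trans (cong f si≡sj) (f-section j)))

arc? : ∀ {n} (G : Digraph n) → ∀ u v → Dec (Arc G u v)
arc? G u v = G u v ≟ᵇ true

saturated⇒arc : ∀ {n B} {G : Digraph n} → Saturated (suc (suc B)) G → (ψ : Fin n → ℕ) →
  (∀ x → ψ x ≤ B) → (∀ {x y} → Arc G x y → ψ x < ψ y) → ∀ {u v} → ψ u < ψ v → Arc G u v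
saturated⇒arc {B = B} {G} (_ , saturate) ψ bounded increasing {u} {v} ψu<ψv =
  decidable-stable (arc? G u v) λ ¬arc → potential⇒¬PathHom B ψ bounded increasing′ (saturate u v u≢v ¬arc)
  where
  u≢v : u ≢ v
  u≢v refl = <-irrefl refl ψu<ψv
  increasing′ : ∀ {x y} → AddArc G u v x y → ψ x < ψ y
  increasing′ (inj₁ arc)           = increasing arc
  increasing′ (inj₂ (refl , refl)) = ψu<ψv

module Depth {n : ℕ} (G : Digraph n) (B : ℕ) (free : HomFree (suc (suc B)) G) where

  WalkTo : ℕ → Fin n → Set
  WalkTo = WalkFrom (flip (Arc G))

  private
    module Longest (v : Fin n) = Greatest (λ m → walk? (flip (arc? G)) m v) tt

  depth : Fin n → ℕ
  depth v = Longest.greatest v B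

  walkTo-bounded : ∀ {m v} → WalkTo m v → m ≤ B
  walkTo-bounded w = ≮⇒≥ λ B<m → free (PathHom-flip {R = Arc G} (walk⇒PathHom _ (walk-shorten _ B<m w)))

  depth-≤ : ∀ v → depth v ≤ B
  depth-≤ v = Longest.greatest-≤ v B

  walkTo-depth : ∀ v → WalkTo (depth v) v
  walkTo-depth v = Longest.greatest-holds v B

  depth-maximal : ∀ {m v} → WalkTo m v → m ≤ depth v
  depth-maximal {v = v} w = Longest.greatest-maximal v B (walkTo-bounded w) w

  depth-increasing : ∀ {u v} → Arc G u v → depth u < depth v
  depth-increasing {u} arc = depth-maximal (u , arc , walkTo-depth u)

  depth-pred : ∀ v m → depth v ≡ suc m → ∃ λ u → depth u ≡ m
  depth-pred v m dv≡1+m with u , arc , w ← subst (λ d → WalkTo d v) dv≡1+m (walkTo-depth v) =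
    u , ≤-antisym (≤-pred (subst (depth u <_) dv≡1+m (depth-increasing arc))) (depth-maximal w)

module SaturatedDepth {n : ℕ} (G : Digraph n) (B : ℕ) (sat : Saturated (suc (suc B)) G) where

  open Depth G B (proj₁ sat) public

  arc⇔depth< : ∀ u v → Arc G u v ⇔ depth u < depth v
  arc⇔depth< u v = mk⇔ depth-increasing (saturated⇒arc sat depth depth-≤ depth-increasing)

  module Collision (below : ∀ x → depth x < B) (u v : Fin n) (u≢v : u ≢ v) (same : depth u ≡ depth v) where

    Raised : Fin n → Set
    Raised x = depth u < depth x ⊎ x ≡ v

    raised? : Decidable Raised
    raised? x = (depth u <? depth x) ⊎-dec (x ≟ᶠ v)

    shift : Fin n → ℕ
    shift x with raised? x
    ... | yes _ = suc (depth x)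
    ... | no  _ = depth x

    shift-≤ : ∀ x → shift x ≤ B
    shift-≤ x with raised? x
    ... | yes _ = below x
    ... | no  _ = <⇒≤ (below x)

    raised-upward : ∀ {x y} → Raised x → depth x < depth y → Raised y
    raised-upward (inj₁ du<dx) dx<dy = inj₁ (<-trans du<dx dx<dy)
    raised-upward (inj₂ refl)  dv<dy = inj₁ (subst (_< _) (sym same) dv<dy)

    shift-increasing : ∀ {x y} → depth x < depth y → shift x < shift y
    shift-increasing {x} {y} dx<dy with raised? x | raised? y
    ... | yes _  | yes _   = s≤s dx<dy
    ... | yes rx | no ¬ry  = ⊥-elim (¬ry (raised-upward rx dx<dy))
    ... | no  _  | yes _   = m<n⇒m<1+n dx<dy
    ... | no  _  | no  _   = dx<dy

    shift-u<shift-v : shift u < shift v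
    shift-u<shift-v with raised? u | raised? v
    ... | yes (inj₁ du<du) | _     = ⊥-elim (<-irrefl refl du<du)
    ... | yes (inj₂ u≡v)   | _     = ⊥-elim (u≢v u≡v)
    ... | no  _            | yes _ = s≤s (≤-reflexive same)
    ... | no  _            | no ¬rv = ⊥-elim (¬rv (inj₂ refl))

    collision-absurd : ⊥
    collision-absurd = <-irrefl same (depth-increasing
      (saturated⇒arc sat shift shift-≤ (shift-increasing ∘ depth-increasing) shift-u<shift-v))

  top-missing⇒depth-injective : (∀ x → depth x < B) → Injective _≡_ _≡_ depth
  top-missing⇒depth-injective below {u} {v} same =
    decidable-stable (u ≟ᶠ v) λ u≢v → Collision.collision-absurd below u v u≢v same

  depth-reaches-top : suc B ≤ n → ∃ λ u → depth u ≡ B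
  depth-reaches-top B<n = decidable-stable (any? λ u → depth u ≟ B) λ ¬top →
    let below : ∀ x → depth x < B
        below x = ≤∧≢⇒< (depth-≤ x) (λ dx≡B → ¬top (x , dx≡B))
    in <⇒notInjective {f = toFin depth below} B<n
         (toFin-injective depth below (top-missing⇒depth-injective below))

  depth-surjective : suc B ≤ n → ∀ t → t ≤ B → ∃ λ u → depth u ≡ t
  depth-surjective B<n t t≤B =
    image-downClosed depth depth-pred top t (subst (t ≤_) (sym top-depth) t≤B)
    where
    top : Fin n
    top = proj₁ (depth-reaches-top B<n)
    top-depth : depth top ≡ B
    top-depth = proj₂ (depth-reaches-top B<n)

mainTheorem3 : (k n : ℕ) → 2 ≤ k → k ∸ 1 ≤ n → (G : Digraph n) →
    Loopless G → Saturated k G →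
    Σ (Fin n → Fin (k ∸ 1)) λ c →
      (∀ u v → Arc G u v ⇔ (c u F.< c v)) ×
      (k ≤ n → ∀ i → ∃ λ u → c u ≡ i) ×
      (n < k → ∀ i u v → c u ≡ i → c v ≡ i → u ≡ v)
mainTheorem3 (suc zero)    _ (s≤s ()) _ _ _ _
mainTheorem3 (suc (suc B)) n _ B<n G _ sat =
  colour , arc⇔colour< , (λ _ → colour-surjective) , λ n<k i u v cu≡i cv≡i →
    surjective⇒injective (≤-pred n<k) colour colour-surjective (trans cu≡i (sym cv≡i))
  where
  open SaturatedDepth G B sat
  depth<1+B : ∀ x → depth x < suc B
  depth<1+B x = s≤s (depth-≤ x)
  colour : Fin n → Fin (suc B)
  colour = toFin depth depth<1+B
  toℕ-colour : ∀ x → toℕ (colour x) ≡ depth x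
  toℕ-colour = toℕ-toFin depth depth<1+B
  arc⇔colour< : ∀ u v → Arc G u v ⇔ toℕ (colour u) < toℕ (colour v)
  arc⇔colour< u v rewrite toℕ-colour u | toℕ-colour v = arc⇔depth< u v
  colour-surjective : ∀ i → ∃ λ u → colour u ≡ i
  colour-surjective i =
    let u , du≡i = depth-surjective B<n (toℕ i) (≤-pred (toℕ<n i))
    in u , toℕ-injective (trans (toℕ-colour u) du≡i)
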